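{- Let $n>1$ and $S\subset\{0,1\}^n$ with $|S|\ge 2^{n-1}$, and let $S^c=\{0,1\}^n\setminus S$. Then $\mathrm{Type}(S^c)=\mathrm{Type}(S)+2^{n-1}-|S|$.
   Context: A half plane of $\{0,1\}^n$ is a set $\{x\in\{0,1\}^n: x_j=a\}$ with $1\le j\le n$, $a\in\{0,1\}$; for $T\subset\{0,1\}^n$, $\mathrm{Type}(T)=\min_H|T\cap H|$ over all $2n$ half planes $H$. -}

module Defs where

open import Data.Nat using (ℕ; zero; suc; _+_; _⊓_; _^_)
open import Data.Bool using (Bool; true; false; not; _∧_; if_then_else_)
open import Data.Bool.Properties using () renaming (_≟_ to _≟ᵇ_)
open import Data.Fin using (Fin)
open import Data.Vec using (Vec; []; _∷_; lookup)
open import Data.List using (List; []; _∷_; map; _++_; concatMap; foldr; length; filter)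
open import Data.Fin.Base using () renaming (zero to fzero; suc to fsuc)
open import Relation.Nullary.Decidable using (⌊_⌋)

-- The cube {0,1}^n : points are length-n Boolean vectors (false = 0, true = 1).
Cube : ℕ → Set
Cube n = Vec Bool n

SubsetCube : ℕ → Set
SubsetCube n = Cube n → Bool

allPoints : (n : ℕ) → List (Cube n)
allPoints zero = [] ∷ []
allPoints (suc n) = map (false ∷_) (allPoints n) ++ map (true ∷_) (allPoints n)

card : {n : ℕ} → SubsetCube n → ℕ
card {n} T = length (filter (λ x → T x ≟ᵇ true) (allPoints n))

compl : {n : ℕ} → SubsetCube n → SubsetCube n
compl S x = not (S x)

halfPlane : {n : ℕ} → Fin n → Bool → SubsetCube n
halfPlane j a x = ⌊ lookup x j ≟ᵇ a ⌋

_∩_ : {n : ℕ} → SubsetCube n → SubsetCube n → SubsetCube n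
(T ∩ U) x = T x ∧ U x

allFin : (n : ℕ) → List (Fin n)
allFin zero = []
allFin (suc n) = fzero ∷ map fsuc (allFin n)

halfPlaneCounts : {n : ℕ} → SubsetCube n → List ℕ
halfPlaneCounts {n} T =
  concatMap (λ j → card (T ∩ halfPlane j false) ∷ card (T ∩ halfPlane j true) ∷ []) (allFin n)

-- Type(T) = min over the 2n half planes H of |T ∩ H|.
-- The fold starts at 2^n, an upper bound for every |T ∩ H|, so for n ≥ 1
-- this is exactly the minimum of the (nonempty) list.
Type : {n : ℕ} → SubsetCube n → ℕ
Type {n} T = foldr _⊓_ (2 ^ n) (halfPlaneCounts T)

-- For a half plane H of {0,1}^n with opposite half plane H', |S^c ∩ H| = 2^(n-1) − |S ∩ H|
-- and |S ∩ H| + |S ∩ H'| = |S|, so |S^c ∩ H| + |S| = |S ∩ H'| + 2^(n-1).  Thus the 2n counts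
-- of S^c are those of S, with opposite half planes exchanged and shifted by 2^(n-1) − |S|,
-- and a minimum commutes with such a shift.
module Submission where

open import Defs
open import Data.Nat using (ℕ; zero; suc; _+_; _∸_; _^_; _⊓_; _≤_; _<_)
open import Data.Nat.Properties
open import Data.Bool using (Bool; true; false; not; _∧_)
open import Data.Bool.Properties using (∧-comm) renaming (_≟_ to _≟ᵇ_)
open import Data.List using (List; []; _∷_; map; _++_; concatMap; foldr; length; filter)
open import Data.List.Properties using (length-++; length-map; length-filter; filter-++)
open import Data.Vec using (_∷_; lookup)
open import Data.Fin using (Fin) renaming (zero to fzero; suc to fsuc)
open import Function using (_∘_)
open import Relation.Binary.PropositionalEquality using (_≡_; refl; sym; trans; cong; cong₂; module ≡-Reasoning)

private
  variable
    A B : Set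
    n : ℕ

count : (A → Bool) → List A → ℕ
count P xs = length (filter (λ x → P x ≟ᵇ true) xs)

count-≤-length : (P : A → Bool) (xs : List A) → count P xs ≤ length xs
count-≤-length P = length-filter (λ x → P x ≟ᵇ true)

count-++ : (P : A → Bool) (xs ys : List A) → count P (xs ++ ys) ≡ count P xs + count P ys
count-++ P xs ys = trans (cong length (filter-++ (λ x → P x ≟ᵇ true) xs ys)) (length-++ (filter (λ x → P x ≟ᵇ true) xs))

count-map : (P : B → Bool) (f : A → B) (xs : List A) → count P (map f xs) ≡ count (P ∘ f) xs
count-map P f [] = refl
count-map P f (x ∷ xs) with P (f x)
... | true  = cong suc (count-map P f xs)
... | false = count-map P f xs

count-cong : {P Q : A → Bool} → (∀ x → P x ≡ Q x) → (xs : List A) → count P xs ≡ count Q xs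
count-cong {P = P} {Q} P≗Q [] = refl
count-cong {P = P} {Q} P≗Q (x ∷ xs) with P x | Q x | P≗Q x
... | true  | .true  | refl = cong suc (count-cong P≗Q xs)
... | false | .false | refl = count-cong P≗Q xs

count-true : (xs : List A) → count (λ _ → true) xs ≡ length xs
count-true []       = refl
count-true (x ∷ xs) = cong suc (count-true xs)

count-false : (xs : List A) → count (λ _ → false) xs ≡ 0
count-false []       = refl
count-false (x ∷ xs) = count-false xs

count-∧-split : (P Q : A → Bool) (xs : List A) →
  count (λ x → P x ∧ Q x) xs + count (λ x → P x ∧ not (Q x)) xs ≡ count P xs
count-∧-split P Q [] = refl
count-∧-split P Q (x ∷ xs) with P x | Q x
... | false | _     = count-∧-split P Q xs
... | true  | true  = cong suc (count-∧-split P Q xs)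
... | true  | false = trans (+-suc _ _) (cong suc (count-∧-split P Q xs))

length-allPoints : ∀ n → length (allPoints n) ≡ 2 ^ n
length-allPoints zero    = refl
length-allPoints (suc n) = begin
  length (map (false ∷_) (allPoints n) ++ map (true ∷_) (allPoints n))
    ≡⟨ length-++ (map (false ∷_) (allPoints n)) ⟩
  length (map (false ∷_) (allPoints n)) + length (map (true ∷_) (allPoints n))
    ≡⟨ cong₂ _+_ (length-map _ (allPoints n)) (length-map _ (allPoints n)) ⟩
  length (allPoints n) + length (allPoints n)
    ≡⟨ cong₂ _+_ (length-allPoints n) (trans (length-allPoints n) (sym (+-identityʳ _))) ⟩
  2 ^ suc n ∎
  where open ≡-Reasoning

card-suc : (P : SubsetCube (suc n)) →
  card P ≡ count (P ∘ (false ∷_)) (allPoints n) + count (P ∘ (true ∷_)) (allPoints n)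
card-suc {n} P = begin
  count P (map (false ∷_) (allPoints n) ++ map (true ∷_) (allPoints n))
    ≡⟨ count-++ P (map (false ∷_) (allPoints n)) _ ⟩
  count P (map (false ∷_) (allPoints n)) + count P (map (true ∷_) (allPoints n))
    ≡⟨ cong₂ _+_ (count-map P _ (allPoints n)) (count-map P _ (allPoints n)) ⟩
  count (P ∘ (false ∷_)) (allPoints n) + count (P ∘ (true ∷_)) (allPoints n) ∎
  where open ≡-Reasoning

card-≤ : (T : SubsetCube n) → card T ≤ 2 ^ n
card-≤ {n} T = ≤-trans (count-≤-length T (allPoints n)) (≤-reflexive (length-allPoints n))

card-halfPlane : (j : Fin (suc n)) (a : Bool) → card (halfPlane j a) ≡ 2 ^ n
card-halfPlane {n} fzero false = begin
  card (halfPlane {suc n} fzero false)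
    ≡⟨ card-suc {n} (halfPlane fzero false) ⟩
  count (λ _ → true) (allPoints n) + count (λ _ → false) (allPoints n)
    ≡⟨ cong₂ _+_ (count-true (allPoints n)) (count-false (allPoints n)) ⟩
  length (allPoints n) + 0
    ≡⟨ trans (+-identityʳ _) (length-allPoints n) ⟩
  2 ^ n ∎
  where open ≡-Reasoning
card-halfPlane {n} fzero true = begin
  card (halfPlane {suc n} fzero true)
    ≡⟨ card-suc {n} (halfPlane fzero true) ⟩
  count (λ _ → false) (allPoints n) + count (λ _ → true) (allPoints n)
    ≡⟨ cong₂ _+_ (count-false (allPoints n)) (count-true (allPoints n)) ⟩
  length (allPoints n)
    ≡⟨ length-allPoints n ⟩
  2 ^ n ∎
  where open ≡-Reasoning
card-halfPlane {suc n} (fsuc j) a = begin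
  card (halfPlane (fsuc j) a)
    ≡⟨ card-suc (halfPlane (fsuc j) a) ⟩
  card (halfPlane j a) + card (halfPlane j a)
    ≡⟨ cong₂ _+_ (card-halfPlane j a) (trans (card-halfPlane j a) (sym (+-identityʳ _))) ⟩
  2 ^ suc n ∎
  where open ≡-Reasoning

halfPlane-not : (j : Fin n) (a : Bool) (x : Cube n) → halfPlane j (not a) x ≡ not (halfPlane j a x)
halfPlane-not j a x with lookup x j | a
... | false | false = refl
... | false | true  = refl
... | true  | false = refl
... | true  | true  = refl

card-∩-halfPlane-split : (T : SubsetCube n) (j : Fin n) (a : Bool) →
  card (T ∩ halfPlane j a) + card (T ∩ halfPlane j (not a)) ≡ card T
card-∩-halfPlane-split {n} T j a = begin
  card (T ∩ halfPlane j a) + card (T ∩ halfPlane j (not a))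
    ≡⟨ cong (card (T ∩ halfPlane j a) +_)
         (count-cong (λ x → cong (T x ∧_) (halfPlane-not j a x)) (allPoints n)) ⟩
  card (T ∩ halfPlane j a) + count (λ x → T x ∧ not (halfPlane j a x)) (allPoints n)
    ≡⟨ count-∧-split T (halfPlane j a) (allPoints n) ⟩
  card T ∎
  where open ≡-Reasoning

card-compl-∩ : (T U : SubsetCube n) → card (compl T ∩ U) + card (T ∩ U) ≡ card U
card-compl-∩ {n} T U = begin
  card (compl T ∩ U) + card (T ∩ U)
    ≡⟨ cong₂ _+_ (count-cong (λ x → ∧-comm (not (T x)) (U x)) (allPoints n))
                 (count-cong (λ x → ∧-comm (T x) (U x)) (allPoints n)) ⟩
  count (λ x → U x ∧ not (T x)) (allPoints n) + count (λ x → U x ∧ T x) (allPoints n)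
    ≡⟨ +-comm (count (λ x → U x ∧ not (T x)) (allPoints n)) _ ⟩
  count (λ x → U x ∧ T x) (allPoints n) + count (λ x → U x ∧ not (T x)) (allPoints n)
    ≡⟨ count-∧-split U T (allPoints n) ⟩
  card U ∎
  where open ≡-Reasoning

card-compl-∩-halfPlane : (S : SubsetCube (suc n)) (j : Fin (suc n)) (a : Bool) →
  card (compl S ∩ halfPlane j a) + card S ≡ card (S ∩ halfPlane j (not a)) + 2 ^ n
card-compl-∩-halfPlane {n} S j a = begin
  c + card S                    ≡⟨ cong (c +_) (sym (card-∩-halfPlane-split S j a)) ⟩
  c + (d a + d (not a))         ≡⟨ sym (+-assoc c (d a) (d (not a))) ⟩
  (c + d a) + d (not a)         ≡⟨ cong (_+ d (not a)) (card-compl-∩ S (halfPlane j a)) ⟩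
  card (halfPlane j a) + d (not a) ≡⟨ cong (_+ d (not a)) (card-halfPlane j a) ⟩
  2 ^ n + d (not a)             ≡⟨ +-comm (2 ^ n) _ ⟩
  d (not a) + 2 ^ n             ∎
  where
  open ≡-Reasoning
  c = card (compl S ∩ halfPlane j a)
  d : Bool → ℕ
  d b = card (S ∩ halfPlane j b)

⊓-foldr-⊓ : (x b : ℕ) (xs : List ℕ) → x ⊓ foldr _⊓_ b xs ≡ foldr _⊓_ (x ⊓ b) xs
⊓-foldr-⊓ x b []       = refl
⊓-foldr-⊓ x b (y ∷ xs) = begin
  x ⊓ (y ⊓ foldr _⊓_ b xs) ≡⟨ sym (⊓-assoc x y _) ⟩
  (x ⊓ y) ⊓ foldr _⊓_ b xs ≡⟨ cong (_⊓ foldr _⊓_ b xs) (⊓-comm x y) ⟩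
  (y ⊓ x) ⊓ foldr _⊓_ b xs ≡⟨ ⊓-assoc y x _ ⟩
  y ⊓ (x ⊓ foldr _⊓_ b xs) ≡⟨ cong (y ⊓_) (⊓-foldr-⊓ x b xs) ⟩
  y ⊓ foldr _⊓_ (x ⊓ b) xs ∎
  where open ≡-Reasoning

foldr-⊓-head : {x b : ℕ} (xs : List ℕ) → x ≤ b → foldr _⊓_ b (x ∷ xs) ≡ foldr _⊓_ x xs
foldr-⊓-head {x} {b} xs x≤b = trans (⊓-foldr-⊓ x b xs) (cong (λ e → foldr _⊓_ e xs) (m≤n⇒m⊓n≡m x≤b))

foldr-⊓-concatMap-pair : (p q : A → ℕ) (b : ℕ) (js : List A) →
  foldr _⊓_ b (concatMap (λ j → p j ∷ q j ∷ []) js) ≡ foldr _⊓_ b (map (λ j → p j ⊓ q j) js)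
foldr-⊓-concatMap-pair p q b []       = refl
foldr-⊓-concatMap-pair p q b (j ∷ js) =
  trans (sym (⊓-assoc (p j) (q j) _)) (cong (p j ⊓ q j ⊓_) (foldr-⊓-concatMap-pair p q b js))

foldr-⊓-+-shift : {f g : A → ℕ} {b b′ s t : ℕ} → b + s ≡ b′ + t → (∀ j → f j + s ≡ g j + t) →
  (js : List A) → foldr _⊓_ b (map f js) + s ≡ foldr _⊓_ b′ (map g js) + t
foldr-⊓-+-shift eb ef []                         = eb
foldr-⊓-+-shift {f = f} {g} {s = s} {t} eb ef (j ∷ js) = begin
  f j ⊓ foldr _⊓_ _ (map f js) + s           ≡⟨ +-distribʳ-⊓ s (f j) _ ⟩
  (f j + s) ⊓ (foldr _⊓_ _ (map f js) + s)   ≡⟨ cong₂ _⊓_ (ef j) (foldr-⊓-+-shift eb ef js) ⟩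
  (g j + t) ⊓ (foldr _⊓_ _ (map g js) + t)   ≡⟨ sym (+-distribʳ-⊓ t (g j) _) ⟩
  g j ⊓ foldr _⊓_ _ (map g js) + t           ∎
  where open ≡-Reasoning

coordMin : SubsetCube n → Fin n → ℕ
coordMin T j = card (T ∩ halfPlane j false) ⊓ card (T ∩ halfPlane j true)

Type-suc : (T : SubsetCube (suc n)) →
  Type T ≡ foldr _⊓_ (coordMin T fzero) (map (coordMin T) (map fsuc (allFin n)))
Type-suc {n} T = begin
  Type T
    ≡⟨ foldr-⊓-concatMap-pair (λ j → card (T ∩ halfPlane j false)) (λ j → card (T ∩ halfPlane j true))
         (2 ^ suc n) (allFin (suc n)) ⟩
  foldr _⊓_ (2 ^ suc n) (map (coordMin T) (allFin (suc n)))
    ≡⟨ foldr-⊓-head (map (coordMin T) (map fsuc (allFin n))) (≤-trans (m⊓n≤m _ _) (card-≤ (T ∩ halfPlane fzero false))) ⟩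
  foldr _⊓_ (coordMin T fzero) (map (coordMin T) (map fsuc (allFin n))) ∎
  where open ≡-Reasoning

coordMin-compl : (S : SubsetCube (suc n)) (j : Fin (suc n)) →
  coordMin (compl S) j + card S ≡ coordMin S j + 2 ^ n
coordMin-compl {n} S j = begin
  c false ⊓ c true + card S                 ≡⟨ +-distribʳ-⊓ (card S) (c false) _ ⟩
  (c false + card S) ⊓ (c true + card S)    ≡⟨ cong₂ _⊓_ (card-compl-∩-halfPlane S j false)
                                                          (card-compl-∩-halfPlane S j true) ⟩
  (d true + 2 ^ n) ⊓ (d false + 2 ^ n)      ≡⟨ ⊓-comm (d true + 2 ^ n) _ ⟩
  (d false + 2 ^ n) ⊓ (d true + 2 ^ n)      ≡⟨ sym (+-distribʳ-⊓ (2 ^ n) (d false) _) ⟩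
  d false ⊓ d true + 2 ^ n                  ∎
  where
  open ≡-Reasoning
  c d : Bool → ℕ
  c a = card (compl S ∩ halfPlane j a)
  d a = card (S ∩ halfPlane j a)

lemma4p9 : (n : ℕ) → 1 < n → (S : SubsetCube n) → 2 ^ (n ∸ 1) ≤ card S →
    Type (compl S) + card S ≡ Type S + 2 ^ (n ∸ 1)
lemma4p9 (suc m) _ S _ = begin
  Type (compl S) + card S
    ≡⟨ cong (_+ card S) (Type-suc (compl S)) ⟩
  foldr _⊓_ (coordMin (compl S) fzero) (map (coordMin (compl S)) js) + card S
    ≡⟨ foldr-⊓-+-shift {f = coordMin (compl S)} (coordMin-compl S fzero) (coordMin-compl S) js ⟩
  foldr _⊓_ (coordMin S fzero) (map (coordMin S) js) + 2 ^ m
    ≡⟨ cong (_+ 2 ^ m) (sym (Type-suc S)) ⟩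
  Type S + 2 ^ m ∎
  where
  open ≡-Reasoning
  js = map fsuc (allFin m)
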